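{- In the no-gaps coin-removal process, a finite row of coins $A$ (encoded as a $0/1$-word) containing at least one heads-up coin is removable if and only if its parity sum $S(A)$ is congruent to $0$ or $1$ modulo $3$.
   Context: Coins in a row are encoded as $1$ (heads-up) and $0$ (tails-up). A move removes a heads-up coin, flips the coins immediately to its left and right (those that exist), and then pushes the remaining coins together so that coins formerly on either side of the removed coin become adjacent. $A$ is removable if some sequence of moves removes all coins. For a word $A$ containing at least one $1$, write $A = 1^{h_0}0^{t_1}1^{h_1}0^{t_2}\cdots 1^{h_{n-1}}0^{t_n}1^{h_n}$ with $n\ge 1$ and non-negative integers $h_i,t_i$ ($x^k$ means $k$ copies of $x$, $x^0$ empty). Put $p_i=(t_1+\dots+t_i)\bmod 2$ and define the parity sum $S(A)=h_0+\sum_{i=1}^n(-1)^{p_i}h_i-p_n$; its value does not depend on the chosen decomposition. -}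

module Defs where

open import Data.Bool using (Bool; true; false; not)
open import Data.Nat using (ℕ; zero; suc; _+_)
open import Data.Nat.DivMod using (_%_)
open import Data.Fin using (Fin; toℕ)
open import Data.List using (List; []; _∷_; _++_; length; lookup; take; drop; replicate; concatMap)
open import Data.List.NonEmpty using (List⁺; toList)
open import Data.Product using (_×_; _,_)
open import Data.Integer using (ℤ; +_; -_) renaming (_+_ to _+ℤ_)
open import Relation.Binary.PropositionalEquality using (_≡_)

-- Coins: true = heads-up (1), false = tails-up (0).
Word : Set
Word = List Bool

flipHead : Word → Word
flipHead []       = []
flipHead (x ∷ xs) = not x ∷ xs

flipLast : Word → Word
flipLast []           = []
flipLast (x ∷ [])     = not x ∷ []
flipLast (x ∷ y ∷ ys) = x ∷ flipLast (y ∷ ys)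

removeAt : (A : Word) → Fin (length A) → Word
removeAt A i = flipLast (take (toℕ i) A) ++ flipHead (drop (suc (toℕ i)) A)

data Removable : Word → Set where
  done : Removable []
  step : (A : Word) (i : Fin (length A)) →
         lookup A i ≡ true → Removable (removeAt A i) → Removable A

-- A decomposition  1^{h_0} 0^{t_1} 1^{h_1} ... 0^{t_n} 1^{h_n}  (n ≥ 1):
-- the number h_0 together with the nonempty list of pairs (t_i , h_i).
record Decomposition : Set where
  constructor decomp
  field
    h₀    : ℕ
    pairs : List⁺ (ℕ × ℕ)

word : Decomposition → Word
word (decomp h₀ ps) =
  replicate h₀ true ++ concatMap (λ { (t , h) → replicate t false ++ replicate h true }) (toList ps)

signed : ℕ → ℕ → ℤ
signed zero    h = + h
signed (suc _) h = - (+ h)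

-- Σ_{i} (-1)^{p_i} h_i - p_n, where c is the running sum t_1+…+t_{i-1}
-- and p_i = (c + t_i) mod 2.
paritySumTail : ℕ → List (ℕ × ℕ) → ℤ
paritySumTail c []              = - (+ (c % 2))
paritySumTail c ((t , h) ∷ ps) = signed ((c + t) % 2) h +ℤ paritySumTail (c + t) ps

paritySum : Decomposition → ℤ
paritySum (decomp h₀ ps) = + h₀ +ℤ paritySumTail 0 (toList ps)

{-# OPTIONS --safe #-}
-- Read a row from right to left as a composite of affine maps applied to 0: a head acts
-- as y ↦ 1 + y and a tail as y ↦ −1 − y.  The resulting integer is exactly S(A).
-- Modulo 3, removing a head that has a left neighbour does not change this value, and
-- removing the leftmost coin never moves it away from 2; since the empty row has value 0,
-- removable rows have S ≢ 2.  Conversely, a row with a head and S ≢ 2 always has a move,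
-- next to its last head, to the empty row or to another such row.
module Submission where

open import Defs
open import Data.Bool using (Bool; true; false; not)
open import Data.Empty using (⊥-elim)
open import Data.Fin using (Fin; toℕ) renaming (zero to fzero; suc to fsuc)
open import Data.Integer as ℤ using (ℤ; +_; -[1+_]; 0ℤ; 1ℤ; -_; _+_)
open import Data.Integer.Properties using (+-identityˡ; +-assoc)
open import Data.Integer.DivMod using (_%ℕ_)
open import Data.Integer.Tactic.RingSolver using (solve-∀)
open import Data.List using ([]; _∷_; _++_; _∷ʳ_; length; lookup; take; drop; replicate; concatMap; initLast; _∷ʳ′_)
open import Data.List.Membership.Propositional using (_∈_; _∉_)
open import Data.List.Membership.Propositional.Properties using (∈-++⁺ˡ; ∈-++⁺ʳ)
open import Data.List.NonEmpty using (toList)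
open import Data.List.Properties using (++-assoc; ∷ʳ-++; concatMap-cong; length-++)
open import Data.List.Relation.Unary.All as All using ()
open import Data.List.Relation.Unary.All.Properties using (replicate⁺)
open import Data.List.Relation.Unary.Any using (here; there)
open import Data.Nat as ℕ using (ℕ; zero; suc; _%_)
open import Data.Nat.Properties using (+-suc; suc-injective)
open import Data.Product using (_×_; _,_)
open import Data.Sum using (_⊎_; inj₁; inj₂)
open import Function using (_∘_)
open import Function.Bundles using (_⇔_; mk⇔)
open import Function.Construct.Composition using (_⇔-∘_)
open import Function.Construct.Symmetry using (⇔-sym)
open import Relation.Binary.PropositionalEquality using (_≡_; _≢_; refl; sym; trans; cong; cong₂; subst; module ≡-Reasoning)

data ℤ₃ : Set where
  0₃ 1₃ 2₃ : ℤ₃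

suc₃ : ℤ₃ → ℤ₃
suc₃ 0₃ = 1₃
suc₃ 1₃ = 2₃
suc₃ 2₃ = 0₃

neg₃ : ℤ₃ → ℤ₃
neg₃ 0₃ = 0₃
neg₃ 1₃ = 2₃
neg₃ 2₃ = 1₃

toℕ₃ : ℤ₃ → ℕ
toℕ₃ 0₃ = 0
toℕ₃ 1₃ = 1
toℕ₃ 2₃ = 2

fromℕ₃ : ℕ → ℤ₃
fromℕ₃ 0 = 0₃
fromℕ₃ 1 = 1₃
fromℕ₃ 2 = 2₃
fromℕ₃ (suc (suc (suc n))) = fromℕ₃ n

[_]₃ : ℤ → ℤ₃
[ + n ]₃ = fromℕ₃ n
[ -[1+ n ] ]₃ = neg₃ (fromℕ₃ (suc n))

neg₃-involutive : ∀ x → neg₃ (neg₃ x) ≡ x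
neg₃-involutive 0₃ = refl
neg₃-involutive 1₃ = refl
neg₃-involutive 2₃ = refl

suc₃-neg₃-suc₃ : ∀ x → suc₃ (neg₃ (suc₃ x)) ≡ neg₃ x
suc₃-neg₃-suc₃ 0₃ = refl
suc₃-neg₃-suc₃ 1₃ = refl
suc₃-neg₃-suc₃ 2₃ = refl

fromℕ₃-suc : ∀ n → fromℕ₃ (suc n) ≡ suc₃ (fromℕ₃ n)
fromℕ₃-suc 0 = refl
fromℕ₃-suc 1 = refl
fromℕ₃-suc 2 = refl
fromℕ₃-suc (suc (suc (suc n))) = fromℕ₃-suc n

[suc]₃ : ∀ z → [ ℤ.suc z ]₃ ≡ suc₃ [ z ]₃
[suc]₃ (+ n) = fromℕ₃-suc n
[suc]₃ -[1+ zero ] = refl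
[suc]₃ -[1+ suc n ] = begin
  neg₃ (fromℕ₃ (suc n))                 ≡⟨ suc₃-neg₃-suc₃ (fromℕ₃ (suc n)) ⟨
  suc₃ (neg₃ (suc₃ (fromℕ₃ (suc n))))   ≡⟨ cong (suc₃ ∘ neg₃) (fromℕ₃-suc (suc n)) ⟨
  suc₃ (neg₃ (fromℕ₃ (suc (suc n))))    ∎
  where open ≡-Reasoning

[-]₃ : ∀ z → [ - z ]₃ ≡ neg₃ [ z ]₃
[-]₃ (+ zero) = refl
[-]₃ (+ suc n) = refl
[-]₃ -[1+ n ] = sym (neg₃-involutive (fromℕ₃ (suc n)))

%3≡toℕ₃fromℕ₃ : ∀ n → n % 3 ≡ toℕ₃ (fromℕ₃ n)
%3≡toℕ₃fromℕ₃ 0 = refl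
%3≡toℕ₃fromℕ₃ 1 = refl
%3≡toℕ₃fromℕ₃ 2 = refl
%3≡toℕ₃fromℕ₃ (suc (suc (suc n))) = %3≡toℕ₃fromℕ₃ n

%ℕ3≡toℕ₃[]₃ : ∀ z → z %ℕ 3 ≡ toℕ₃ [ z ]₃
%ℕ3≡toℕ₃[]₃ (+ n) = %3≡toℕ₃fromℕ₃ n
%ℕ3≡toℕ₃[]₃ -[1+ n ] rewrite %3≡toℕ₃fromℕ₃ (suc n) with fromℕ₃ (suc n)
... | 0₃ = refl
... | 1₃ = refl
... | 2₃ = refl

%ℕ3∈01⇔[]₃≢2 : ∀ z → (z %ℕ 3 ≡ 0 ⊎ z %ℕ 3 ≡ 1) ⇔ [ z ]₃ ≢ 2₃
%ℕ3∈01⇔[]₃≢2 z rewrite %ℕ3≡toℕ₃[]₃ z = mk⇔ to from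
  where
  to : ∀ {x} → toℕ₃ x ≡ 0 ⊎ toℕ₃ x ≡ 1 → x ≢ 2₃
  to (inj₁ ()) refl
  to (inj₂ ()) refl
  from : ∀ {x} → x ≢ 2₃ → toℕ₃ x ≡ 0 ⊎ toℕ₃ x ≡ 1
  from {0₃} _ = inj₁ refl
  from {1₃} _ = inj₂ refl
  from {2₃} x≢2 = ⊥-elim (x≢2 refl)

reflect : ℤ → ℤ
reflect y = - (1ℤ + y)

reflect-involutive : ∀ y → reflect (reflect y) ≡ y
reflect-involutive = identity
  where
  identity : ∀ y → - (1ℤ + - (1ℤ + y)) ≡ y
  identity = solve-∀

reflect-+ : ∀ x y → reflect (x + y) ≡ - x + reflect y
reflect-+ = identity
  where
  identity : ∀ x y → - (1ℤ + (x + y)) ≡ - x + - (1ℤ + y)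
  identity = solve-∀

reflectⁿ : ℕ → ℤ → ℤ
reflectⁿ zero    y = y
reflectⁿ (suc n) y = reflect (reflectⁿ n y)

reflectⁿ-+ : ∀ m n y → reflectⁿ (m ℕ.+ n) y ≡ reflectⁿ m (reflectⁿ n y)
reflectⁿ-+ zero    n y = refl
reflectⁿ-+ (suc m) n y = cong reflect (reflectⁿ-+ m n y)

reflectⁿ-0 : ∀ n → reflectⁿ n 0ℤ ≡ - + (n % 2)
reflectⁿ-0 0 = refl
reflectⁿ-0 1 = refl
reflectⁿ-0 (suc (suc n)) = trans (reflect-involutive (reflectⁿ n 0ℤ)) (reflectⁿ-0 n)

reflectⁿ-+ˡ : ∀ n h y → reflectⁿ n (+ h + y) ≡ signed (n % 2) h + reflectⁿ n y
reflectⁿ-+ˡ 0 h y = refl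
reflectⁿ-+ˡ 1 h y = reflect-+ (+ h) y
reflectⁿ-+ˡ (suc (suc n)) h y = begin
  reflect (reflect (reflectⁿ n (+ h + y)))   ≡⟨ reflect-involutive _ ⟩
  reflectⁿ n (+ h + y)                       ≡⟨ reflectⁿ-+ˡ n h y ⟩
  signed (n % 2) h + reflectⁿ n y            ≡⟨ cong (_+_ (signed (n % 2) h)) (reflect-involutive _) ⟨
  signed (n % 2) h + reflect (reflect (reflectⁿ n y)) ∎
  where open ≡-Reasoning

value : Word → ℤ
value []          = 0ℤ
value (true ∷ w)  = 1ℤ + value w
value (false ∷ w) = reflect (value w)

value-heads : ∀ h w → value (replicate h true ++ w) ≡ + h + value w
value-heads zero    w = sym (+-identityˡ (value w))
value-heads (suc h) w = trans (cong (_+_ 1ℤ) (value-heads h w)) (sym (+-assoc 1ℤ (+ h) (value w)))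

value-tails : ∀ t w → value (replicate t false ++ w) ≡ reflectⁿ t (value w)
value-tails zero    w = refl
value-tails (suc t) w = cong reflect (value-tails t w)

block : ℕ × ℕ → Word
block (t , h) = replicate t false ++ replicate h true

value-block : ∀ t h w → value (block (t , h) ++ w) ≡ reflectⁿ t (+ h + value w)
value-block t h w = begin
  value ((replicate t false ++ replicate h true) ++ w)  ≡⟨ cong value (++-assoc (replicate t false) _ w) ⟩
  value (replicate t false ++ replicate h true ++ w)    ≡⟨ value-tails t _ ⟩
  reflectⁿ t (value (replicate h true ++ w))            ≡⟨ cong (reflectⁿ t) (value-heads h w) ⟩
  reflectⁿ t (+ h + value w)                            ∎
  where open ≡-Reasoning

paritySumTail≡reflectⁿ-value : ∀ c ps → paritySumTail c ps ≡ reflectⁿ c (value (concatMap block ps))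
paritySumTail≡reflectⁿ-value c [] = sym (reflectⁿ-0 c)
paritySumTail≡reflectⁿ-value c ((t , h) ∷ ps) = begin
  signed (n % 2) h + paritySumTail n ps  ≡⟨ cong (_+_ (signed (n % 2) h)) (paritySumTail≡reflectⁿ-value n ps) ⟩
  signed (n % 2) h + reflectⁿ n v        ≡⟨ reflectⁿ-+ˡ n h v ⟨
  reflectⁿ n (+ h + v)                   ≡⟨ reflectⁿ-+ c t _ ⟩
  reflectⁿ c (reflectⁿ t (+ h + v))      ≡⟨ cong (reflectⁿ c) (value-block t h _) ⟨
  reflectⁿ c (value (block (t , h) ++ rest)) ∎
  where
  open ≡-Reasoning
  n    = c ℕ.+ t
  rest = concatMap block ps
  v    = value rest

word-decomp : ∀ h₀ ps → word (decomp h₀ ps) ≡ replicate h₀ true ++ concatMap block (toList ps)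
word-decomp h₀ ps = cong (replicate h₀ true ++_) (concatMap-cong (λ _ → refl) (toList ps))

paritySum≡value : ∀ D → paritySum D ≡ value (word D)
paritySum≡value (decomp h₀ ps) = begin
  + h₀ + paritySumTail 0 (toList ps)          ≡⟨ cong (_+_ (+ h₀)) (paritySumTail≡reflectⁿ-value 0 (toList ps)) ⟩
  + h₀ + value (concatMap block (toList ps))  ≡⟨ value-heads h₀ _ ⟨
  value (replicate h₀ true ++ concatMap block (toList ps)) ≡⟨ cong value (word-decomp h₀ ps) ⟨
  value (word (decomp h₀ ps))                 ∎
  where open ≡-Reasoning

reflect₃ : ℤ₃ → ℤ₃
reflect₃ x = neg₃ (suc₃ x)

reflect₃-involutive : ∀ x → reflect₃ (reflect₃ x) ≡ x
reflect₃-involutive 0₃ = refl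
reflect₃-involutive 1₃ = refl
reflect₃-involutive 2₃ = refl

⟦_⟧₃ : Bool → ℤ₃ → ℤ₃
⟦ true  ⟧₃ = suc₃
⟦ false ⟧₃ = reflect₃

value₃ : Word → ℤ₃
value₃ []      = 0₃
value₃ (b ∷ w) = ⟦ b ⟧₃ (value₃ w)

[value]₃≡value₃ : ∀ w → [ value w ]₃ ≡ value₃ w
[value]₃≡value₃ []          = refl
[value]₃≡value₃ (true ∷ w)  = trans ([suc]₃ (value w)) (cong suc₃ ([value]₃≡value₃ w))
[value]₃≡value₃ (false ∷ w) = begin
  [ - (1ℤ + value w) ]₃   ≡⟨ [-]₃ (1ℤ + value w) ⟩
  neg₃ [ 1ℤ + value w ]₃  ≡⟨ cong neg₃ ([suc]₃ (value w)) ⟩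
  reflect₃ [ value w ]₃   ≡⟨ cong reflect₃ ([value]₃≡value₃ w) ⟩
  reflect₃ (value₃ w)     ∎
  where open ≡-Reasoning

flip-neighbours₃ : ∀ a b x → ⟦ not a ⟧₃ (⟦ not b ⟧₃ x) ≡ ⟦ a ⟧₃ (suc₃ (⟦ b ⟧₃ x))
flip-neighbours₃ true  true  = λ { 0₃ → refl ; 1₃ → refl ; 2₃ → refl }
flip-neighbours₃ true  false = λ { 0₃ → refl ; 1₃ → refl ; 2₃ → refl }
flip-neighbours₃ false true  = λ { 0₃ → refl ; 1₃ → refl ; 2₃ → refl }
flip-neighbours₃ false false = λ { 0₃ → refl ; 1₃ → refl ; 2₃ → refl }

value₃-move : ∀ a L R → value₃ (flipLast (a ∷ L) ++ flipHead R) ≡ value₃ ((a ∷ L) ++ true ∷ R)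
value₃-move true  []      []      = refl
value₃-move false []      []      = refl
value₃-move a     []      (b ∷ R) = flip-neighbours₃ a b (value₃ R)
value₃-move a     (b ∷ L) R       = cong ⟦ a ⟧₃ (value₃-move b L R)

flip-neighbour₃-keeps-2 : ∀ b x → suc₃ (⟦ b ⟧₃ x) ≡ 2₃ → ⟦ not b ⟧₃ x ≡ 2₃
flip-neighbour₃-keeps-2 true  0₃ _ = refl
flip-neighbour₃-keeps-2 false 1₃ _ = refl
flip-neighbour₃-keeps-2 true  1₃ ()
flip-neighbour₃-keeps-2 true  2₃ ()
flip-neighbour₃-keeps-2 false 0₃ ()
flip-neighbour₃-keeps-2 false 2₃ ()

value₃-move-keeps-2 : ∀ L R → value₃ (L ++ true ∷ R) ≡ 2₃ → value₃ (flipLast L ++ flipHead R) ≡ 2₃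
value₃-move-keeps-2 []      []      ()
value₃-move-keeps-2 []      (b ∷ R) = flip-neighbour₃-keeps-2 b (value₃ R)
value₃-move-keeps-2 (a ∷ L) R       = trans (value₃-move a L R)

take++lookup∷drop : ∀ (A : Word) i → take (toℕ i) A ++ lookup A i ∷ drop (suc (toℕ i)) A ≡ A
take++lookup∷drop (x ∷ A) fzero    = refl
take++lookup∷drop (x ∷ A) (fsuc i) = cong (x ∷_) (take++lookup∷drop A i)

removable⇒value₃≢2 : ∀ {A} → Removable A → value₃ A ≢ 2₃
removable⇒value₃≢2 done ()
removable⇒value₃≢2 (step A i heads rest) =
  removable⇒value₃≢2 rest ∘ value₃-move-keeps-2 L R ∘ trans (cong value₃ split)
  where
  L = take (toℕ i) A
  R = drop (suc (toℕ i)) A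
  split : L ++ true ∷ R ≡ A
  split = subst (λ b → L ++ b ∷ R ≡ A) heads (take++lookup∷drop A i)

position : ∀ L R → Fin (length (L ++ true ∷ R))
position []      R = fzero
position (x ∷ L) R = fsuc (position L R)

lookup-position : ∀ L R → lookup (L ++ true ∷ R) (position L R) ≡ true
lookup-position []      R = refl
lookup-position (x ∷ L) R = lookup-position L R

take-position : ∀ L R → take (toℕ (position L R)) (L ++ true ∷ R) ≡ L
take-position []      R = refl
take-position (x ∷ L) R = cong (x ∷_) (take-position L R)

drop-position : ∀ L R → drop (suc (toℕ (position L R))) (L ++ true ∷ R) ≡ R
drop-position []      R = refl
drop-position (x ∷ L) R = drop-position L R

removeAt-position : ∀ L R → removeAt (L ++ true ∷ R) (position L R) ≡ flipLast L ++ flipHead R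
removeAt-position L R =
  cong₂ (λ L′ R′ → flipLast L′ ++ flipHead R′) (take-position L R) (drop-position L R)

move : ∀ L R → Removable (flipLast L ++ flipHead R) → Removable (L ++ true ∷ R)
move L R rest = step (L ++ true ∷ R) (position L R) (lookup-position L R)
  (subst Removable (sym (removeAt-position L R)) rest)

length-flipLast : ∀ L → length (flipLast L) ≡ length L
length-flipLast []          = refl
length-flipLast (x ∷ [])    = refl
length-flipLast (x ∷ y ∷ L) = cong suc (length-flipLast (y ∷ L))

length-flipHead : ∀ R → length (flipHead R) ≡ length R
length-flipHead []      = refl
length-flipHead (x ∷ R) = refl

length-move : ∀ L R → length (L ++ true ∷ R) ≡ suc (length (flipLast L ++ flipHead R))
length-move L R = begin
  length (L ++ true ∷ R)                             ≡⟨ length-++ L ⟩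
  length L ℕ.+ suc (length R)                        ≡⟨ +-suc (length L) (length R) ⟩
  suc (length L ℕ.+ length R)                        ≡⟨ cong suc (cong₂ ℕ._+_ (length-flipLast L) (length-flipHead R)) ⟨
  suc (length (flipLast L) ℕ.+ length (flipHead R))  ≡⟨ cong suc (length-++ (flipLast L)) ⟨
  suc (length (flipLast L ++ flipHead R))            ∎
  where open ≡-Reasoning

flipLast-∷ʳ : ∀ Q a → flipLast (Q ∷ʳ a) ≡ Q ∷ʳ not a
flipLast-∷ʳ []          a = refl
flipLast-∷ʳ (x ∷ [])    a = refl
flipLast-∷ʳ (x ∷ y ∷ Q) a = cong (x ∷_) (flipLast-∷ʳ (y ∷ Q) a)

true∉replicate-false : ∀ k → true ∉ replicate k false
true∉replicate-false k heads with All.lookup (replicate⁺ {P = _≡ false} k refl) heads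
... | ()

value₃-head-tails≢2 : ∀ k → value₃ (true ∷ replicate k false) ≢ 2₃
value₃-head-tails≢2 zero          ()
value₃-head-tails≢2 (suc zero)    ()
value₃-head-tails≢2 (suc (suc k)) =
  subst (λ x → suc₃ x ≢ 2₃) (sym (reflect₃-involutive (value₃ (replicate k false))))
    (value₃-head-tails≢2 k)

Good : Word → Set
Good A = true ∈ A × value₃ A ≢ 2₃

data GoodMove : Word → Set where
  last-coin : GoodMove (true ∷ [])
  move-to   : ∀ L R → Good (flipLast L ++ flipHead R) → GoodMove (L ++ true ∷ R)

good-move-after : ∀ a L R → value₃ ((a ∷ L) ++ true ∷ R) ≢ 2₃ →
                  true ∈ flipLast (a ∷ L) ++ flipHead R → GoodMove ((a ∷ L) ++ true ∷ R)
good-move-after a L R v heads = move-to (a ∷ L) R (heads , v ∘ trans (sym (value₃-move a L R)))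

good-move-after-∷ʳ : ∀ Q a R → value₃ ((Q ∷ʳ a) ++ true ∷ R) ≢ 2₃ →
                     true ∈ flipLast (Q ∷ʳ a) ++ flipHead R → GoodMove ((Q ∷ʳ a) ++ true ∷ R)
good-move-after-∷ʳ []      a R = good-move-after a [] R
good-move-after-∷ʳ (q ∷ Q) a R = good-move-after q (Q ∷ʳ a) R

∈-flipLast-∷ʳ : ∀ {Q a} → true ∈ Q ∷ʳ not a → true ∈ flipLast (Q ∷ʳ a)
∈-flipLast-∷ʳ {Q} {a} = subst (true ∈_) (sym (flipLast-∷ʳ Q a))

true∈flipLast-replicate-false : ∀ m → true ∈ flipLast (replicate (suc m) false)
true∈flipLast-replicate-false zero    = here refl
true∈flipLast-replicate-false (suc m) = there (true∈flipLast-replicate-false m)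

data LastHead : Word → Set where
  no-heads  : ∀ k → LastHead (replicate k false)
  last-head : ∀ P k → LastHead (P ++ true ∷ replicate k false)

lastHead : ∀ A → LastHead A
lastHead []      = no-heads 0
lastHead (b ∷ A) with lastHead A
... | last-head P k = last-head (b ∷ P) k
lastHead (true  ∷ _) | no-heads k = last-head [] k
lastHead (false ∷ _) | no-heads k = no-heads (suc k)

-- Remove the last head, except in a row 0ᵐ⁺¹11: there that would leave no head behind,
-- so the first head is removed instead.
goodMove : ∀ A → Good A → GoodMove A
goodMove A (heads , v) with lastHead A
... | no-heads k = ⊥-elim (true∉replicate-false k heads)
... | last-head P (suc k) with initLast P
...   | []       = move-to [] (false ∷ replicate k false) (here refl , value₃-head-tails≢2 k)
...   | Q ∷ʳ′ a  = good-move-after-∷ʳ Q a _ v (∈-++⁺ʳ (flipLast (Q ∷ʳ a)) (here refl))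
goodMove A (heads , v) | last-head P zero with initLast P
... | []           = last-coin
... | Q ∷ʳ′ false  = good-move-after-∷ʳ Q false [] v (∈-++⁺ˡ (∈-flipLast-∷ʳ (∈-++⁺ʳ Q (here refl))))
... | Q ∷ʳ′ true with lastHead Q
...   | last-head Q′ j =
  good-move-after-∷ʳ Q true [] v (∈-++⁺ˡ (∈-flipLast-∷ʳ (∈-++⁺ˡ (∈-++⁺ʳ Q′ (here refl)))))
...   | no-heads zero    = ⊥-elim (v refl)
...   | no-heads (suc m) = subst GoodMove (sym assoc)
  (good-move-after false zeros (true ∷ []) (v ∘ trans (cong value₃ assoc))
    (∈-++⁺ˡ (true∈flipLast-replicate-false m)))
  where
  zeros = replicate m false
  assoc = ∷ʳ-++ (false ∷ zeros) true (true ∷ [])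

good⇒removable : ∀ n A → length A ≡ n → Good A → Removable A
good⇒removable zero    []      _   (() , _)
good⇒removable zero    (_ ∷ _) ()  _
good⇒removable (suc n) A       len good with goodMove A good
... | last-coin       = move [] [] done
... | move-to L R good′ =
  move L R (good⇒removable n _ (suc-injective (trans (sym (length-move L R)) len)) good′)

removable⇔[value]₃≢2 : ∀ A → true ∈ A → Removable A ⇔ [ value A ]₃ ≢ 2₃
removable⇔[value]₃≢2 A heads rewrite [value]₃≡value₃ A =
  mk⇔ removable⇒value₃≢2 (λ v → good⇒removable _ A refl (heads , v))

proposition2 : (A : Word) → true ∈ A → (D : Decomposition) → word D ≡ A →
    (Removable A ⇔ (paritySum D %ℕ 3 ≡ 0 ⊎ paritySum D %ℕ 3 ≡ 1))
proposition2 A heads D refl rewrite paritySum≡value D =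
  ⇔-sym (%ℕ3∈01⇔[]₃≢2 (value (word D))) ⇔-∘ removable⇔[value]₃≢2 (word D) heads
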